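{- Let $s$ and $t$ be positive integers. Then: (i) $C(s,t+1)\ge C(s,t)$; (ii) $C(s,t+1)\ge 2C(s,t)$ for $s>2$.
   Context: $C$ is defined on positive integers by $C(1,t)=1$ for all $t$; $C(s,1)=2$ for all $s>1$; $C(s,t)=C(s,t-1)\,C(s-1,C(s,t-1))$ for $s,t>1$. -}

module Defs where

open import Data.Nat using (ℕ; zero; suc; _*_)

-- C(s,t) on positive integers, as in the paper:
--   C(1,t) = 1;  C(s,1) = 2 for s > 1;  C(s,t) = C(s,t-1) * C(s-1, C(s,t-1)) for s,t > 1.
-- Arguments equal to 0 lie outside the paper's domain; we assign junk values
-- (C 0 t = 1, C s 0 = 1 for s > 1) that are never used by the statement.
C : ℕ → ℕ → ℕ
C zero _ = 1
C (suc zero) _ = 1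
C (suc (suc s)) zero = 1
C (suc (suc s)) (suc zero) = 2
C (suc (suc s)) (suc (suc t)) =
  C (suc (suc s)) (suc t) * C (suc s) (C (suc (suc s)) (suc t))

{-# OPTIONS --safe #-}
module Submission where

open import Defs
open import Data.Nat using (ℕ; _*_; _≤_; _<_; _+_; zero; suc; s≤s; NonZero)
open import Data.Nat.Properties
open import Data.Product using (_×_; _,_)

-- Unfolding C(s, t+1) = x · C(s-1, x) with x = C(s,t) ≥ 1: the second factor is
-- at least 1, and at least 2 once s-1 ≥ 2 (C(s-1, ·) starts at 2 and never decreases).

C-nonZero : ∀ s t → NonZero (C s t)
C-nonZero zero _ = _
C-nonZero (suc zero) _ = _
C-nonZero (suc (suc s)) zero = _
C-nonZero (suc (suc s)) (suc zero) = _
C-nonZero (suc (suc s)) (suc (suc t)) =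
  m*n≢0 x (C (suc s) x) {{C-nonZero (suc (suc s)) (suc t)}} {{C-nonZero (suc s) x}}
  where x = C (suc (suc s)) (suc t)

C-≤-C-suc : ∀ s t → C s t ≤ C s (suc t)
C-≤-C-suc zero t = ≤-refl
C-≤-C-suc (suc zero) t = ≤-refl
C-≤-C-suc (suc (suc s)) zero = m≤n*m 1 2
C-≤-C-suc (suc (suc s)) (suc t) = m≤m*n x (C (suc s) x) {{C-nonZero (suc s) x}}
  where x = C (suc (suc s)) (suc t)

2≤C : ∀ s t .{{_ : NonZero t}} → 2 ≤ C (suc (suc s)) t
2≤C s (suc zero) = ≤-refl
2≤C s (suc (suc t)) = ≤-trans (2≤C s (suc t)) (C-≤-C-suc (suc (suc s)) (suc t))

2*C≤C-suc : ∀ s t → 2 * C (suc (suc (suc s))) t ≤ C (suc (suc (suc s))) (suc t)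
2*C≤C-suc s zero = ≤-refl
2*C≤C-suc s (suc t) = begin
  2 * x                  ≡⟨ *-comm 2 x ⟩
  x * 2                  ≤⟨ *-monoʳ-≤ x (2≤C s x {{C-nonZero (suc (suc (suc s))) (suc t)}}) ⟩
  x * C (suc (suc s)) x  ∎
  where
  open ≤-Reasoning
  x = C (suc (suc (suc s))) (suc t)

-- Both hypotheses 1 ≤ s and 1 ≤ t are unused: the junk values C 0 t = C s 0 = 1
-- satisfy both inequalities as well.
mainTheorem5 : (s t : ℕ) → 1 ≤ s → 1 ≤ t →
    (C s t ≤ C s (t + 1)) × (2 < s → 2 * C s t ≤ C s (t + 1))
mainTheorem5 s t _ _ rewrite +-comm t 1 = C-≤-C-suc s t , doubling s
  where
  doubling : ∀ r → 2 < r → 2 * C r t ≤ C r (suc t)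
  doubling (suc zero) (s≤s ())
  doubling (suc (suc zero)) (s≤s (s≤s ()))
  doubling (suc (suc (suc r))) _ = 2*C≤C-suc r t
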